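{- Let $\mathcal{C}=\mathcal{C}(C_{n_1},\dots,C_{n_m})$ be a chain cycle of either of the following two types: (i) all $n_i$ even, obtained by identifying $v^i_{\frac{n_i}{2}+1}$ with $v^{i+1}_1$ for $i=1,\dots,m-1$; or (ii) all $n_i$ odd, obtained by identifying $v^i_{\frac{n_i+1}{2}+1}$ with $v^{i+1}_1$ for $i=1,\dots,m-1$. Let $V_1=\{v^2_1,v^3_1,\dots,v^m_1\}$. If $x\in V_1$ and $y\in V(\mathcal{C})$, then $x$ and $y$ are not mutually maximally distant in $\mathcal{C}$.
   Context: The cycles $C_{n_1},\dots,C_{n_m}$ are pairwise disjoint, $V(C_{n_i})=\{v^i_1,\dots,v^i_{n_i}\}$ with $v^i_j$ adjacent to $v^i_{j+1}$ ($1\le j<n_i$) and $v^i_{n_i}$ adjacent to $v^i_1$; the chain cycle is the graph obtained from their disjoint union by the stated identifications. In a connected graph $G$ with shortest-path distance $d$, a vertex $u$ is maximally distant from $v$ if $d(v,w)\le d(u,v)$ for every neighbor $w$ of $u$; $u$ and $v$ are mutually maximally distant if each is maximally distant from the other. -}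

module Defs where

open import Data.Nat using (ℕ; zero; suc; _≤_; _/_)
open import Data.Nat.Properties using ()
open import Data.Fin using (Fin; toℕ)
open import Data.Product using (Σ; _×_; _,_; proj₁; proj₂; ∃)
open import Data.Sum using (_⊎_)
open import Relation.Binary.PropositionalEquality using (_≡_)

-- Conventions: cycles are indexed by i : Fin m (cycle C_{n_{i+1}} of the paper),
-- vertex v^{i+1}_{j+1} of the paper is (i , j) with j : Fin (n i).

data ChainType : Set where
  evenType oddType : ChainType

-- 0-based index (in cycle i) of the vertex identified with v^{i+1}_1:
--   type (i):  v^i_{n_i/2 + 1}      ↦ index n_i / 2
--   type (ii): v^i_{(n_i+1)/2 + 1}  ↦ index (n_i + 1) / 2
midIdx : ChainType → ℕ → ℕ
midIdx evenType n = n / 2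
midIdx oddType  n = suc n / 2

data Even : ℕ → Set where
  even : (k : ℕ) → Even (k Data.Nat.+ k)

TypeOK : ChainType → ℕ → Set
TypeOK evenType n = Even n
TypeOK oddType  n = Even (suc n)

CAdj : ℕ → ℕ → ℕ → Set
CAdj N a b = suc a ≡ b ⊎ suc b ≡ a ⊎ (suc a ≡ N × b ≡ 0) ⊎ (suc b ≡ N × a ≡ 0)

module ChainCycle {m : ℕ} (n : Fin m → ℕ) (t : ChainType) where

  V : Set
  V = Σ (Fin m) (λ i → Fin (n i))

  Ident : V → V → Set
  Ident u w = suc (toℕ (proj₁ u)) ≡ toℕ (proj₁ w)
            × toℕ (proj₂ u) ≡ midIdx t (n (proj₁ u))
            × toℕ (proj₂ w) ≡ 0

  -- equality of vertices of the chain cycle (the identification classes)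
  _≈_ : V → V → Set
  u ≈ w = u ≡ w ⊎ Ident u w ⊎ Ident w u

  EdgeU : V → V → Set
  EdgeU u w = proj₁ u ≡ proj₁ w × CAdj (n (proj₁ u)) (toℕ (proj₂ u)) (toℕ (proj₂ w))

  Adj : V → V → Set
  Adj u w = ∃ λ u' → ∃ λ w' → u ≈ u' × w ≈ w' × EdgeU u' w'

  data Walk : V → V → ℕ → Set where
    here : ∀ {u v} → u ≈ v → Walk u v 0
    step : ∀ {u w v k} → Adj u w → Walk w v k → Walk u v (suc k)

  Dist : V → V → ℕ → Set
  Dist u v k = Walk u v k × (∀ k' → Walk u v k' → k ≤ k')

  MaxDistFrom : V → V → Set
  MaxDistFrom u v = ∀ w → Adj u w → ∀ a b → Dist v w a → Dist u v b → a ≤ b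

  MutuallyMaxDist : V → V → Set
  MutuallyMaxDist u v = MaxDistFrom u v × MaxDistFrom v u

  InV₁ : V → Set
  InV₁ x = 1 ≤ toℕ (proj₁ x) × toℕ (proj₂ x) ≡ 0

module Submission where

-- Every vertex x = v^I_1 with I ≥ 2 (paper indexing) is a cut vertex of the chain
-- cycle: removing it separates the cycles before C_{n_I} (together with all of
-- C_{n_{I-1}} except its attachment vertex, which is x itself) from C_{n_I} and
-- the cycles after it, and x has a neighbour on each side.  Hence, whichever side
-- y lies on (or if y is x), x has a neighbour w on the other side; every walk from
-- y to w passes through x strictly before its end, so d(y,w) > d(y,x) and x is not
-- maximally distant from y.

open import Defs
open import Data.Nat using (ℕ; zero; suc; _+_; _*_; _≤_; _<_; z≤n; s≤s; s≤s⁻¹; pred; >-nonZero; _/_; _<?_; _≟_; _≤?_)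
open import Data.Nat.Properties
open import Data.Nat.DivMod using (m*n/n≡m)
open import Data.Fin using (Fin; toℕ; fromℕ<; inject₁) renaming (zero to fzero; suc to fsuc)
open import Data.Fin.Properties using (toℕ-injective; toℕ-fromℕ<; toℕ-inject₁; toℕ<n)
open import Data.Product using (∃; _×_; _,_; proj₁; proj₂)
open import Data.Sum using (_⊎_; inj₁; inj₂)
open import Data.Empty using (⊥-elim)
open import Relation.Nullary using (¬_; Dec; yes; no)
open import Relation.Nullary.Decidable using (_×-dec_)
open import Relation.Binary.PropositionalEquality

half-double : ∀ k → (k + k) / 2 ≡ k
half-double k = begin
  (k + k) / 2       ≡⟨ cong (λ z → (k + z) / 2) (sym (+-identityʳ k)) ⟩
  (2 * k) / 2       ≡⟨ cong (_/ 2) (*-comm 2 k) ⟩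
  (k * 2) / 2       ≡⟨ m*n/n≡m k 2 ⟩
  k                 ∎
  where open ≡-Reasoning

halves : ∀ {M} → Even M → ∃ λ k → M ≡ k + k
halves (even k) = k , refl

Interior : ChainType → ℕ → Set
Interior t N = 1 ≤ midIdx t N × midIdx t N < N

-- Under the hypotheses of the theorem (N ≥ 3 and the parity of the type) the
-- attachment index is interior: for N = 2k it is k, and for N + 1 = 2k it is k,
-- where N ≥ 3 forces k ≥ 2 and hence k < N.
interior : ∀ t {N} → 3 ≤ N → TypeOK t N → Interior t N
interior evenType 3≤N (even zero) = ⊥-elim (≤⇒≯ 3≤N (s≤s z≤n))
interior evenType _ (even (suc k)) rewrite half-double (suc k) =
  s≤s z≤n , m<m+n (suc k) (s≤s z≤n)
interior oddType 3≤N N+1-even with halves N+1-even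
... | zero , ()
... | suc zero , N+1≡2 = ⊥-elim (≤⇒≯ 3≤N (≤-trans (≤-reflexive N+1≡2) (n≤1+n 2)))
... | suc (suc j) , N+1≡k+k rewrite cong (_/ 2) N+1≡k+k | half-double (suc (suc j)) =
  s≤s z≤n , subst (suc (suc j) <_) (sym (suc-injective N+1≡k+k)) (s≤s (m≤n+m (suc (suc j)) j))

Least : (ℕ → Set) → Set
Least P = ∃ λ j → P j × (∀ j' → P j' → j ≤ j')

-- Constructive well-ordering: a satisfiable predicate cannot fail to have a least
-- witness (P is not assumed decidable, hence the double negation).  This is how
-- walks give rise to distances.
least-witness : ∀ {P : ℕ → Set} k → P k → ¬ ¬ Least P
least-witness {P} k pk no-least = none-below (suc k) k ≤-refl pk
  where
  none-below : ∀ N j → j < N → ¬ P j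
  none-below (suc N) j (s≤s j≤N) pj = no-least (j , pj , j-least)
    where
    j-least : ∀ j' → P j' → j ≤ j'
    j-least j' pj' with j ≤? j'
    ... | yes j≤j' = j≤j'
    ... | no j≰j' = ⊥-elim (none-below N j' (<-≤-trans (≰⇒> j≰j') j≤N) pj')

predecessor : ∀ {m} (i : Fin m) → 1 ≤ toℕ i → ∃ λ (j : Fin m) → suc (toℕ j) ≡ toℕ i
predecessor (fsuc j) _ = inject₁ j , cong suc (toℕ-inject₁ j)

first-index : ∀ {m} → Fin m → ∃ λ (i : Fin m) → toℕ i ≡ 0
first-index fzero    = fzero , refl
first-index (fsuc _) = fzero , refl

CAdj-sym : ∀ {N a b} → CAdj N a b → CAdj N b a
CAdj-sym (inj₁ a→b)                = inj₂ (inj₁ a→b)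
CAdj-sym (inj₂ (inj₁ b→a))         = inj₁ b→a
CAdj-sym (inj₂ (inj₂ (inj₁ wrap))) = inj₂ (inj₂ (inj₂ wrap))
CAdj-sym (inj₂ (inj₂ (inj₂ wrap))) = inj₂ (inj₂ (inj₁ wrap))

-- Everything below holds for any chain cycle whose attachment vertices are
-- interior, with arbitrary cycle lengths.
module Interior-chain {m : ℕ} (n : Fin m → ℕ) (t : ChainType)
                      (interior-at : ∀ i → Interior t (n i)) where
  open ChainCycle n t

  cyc pos : V → ℕ
  cyc u = toℕ (proj₁ u)
  pos u = toℕ (proj₂ u)

  mid : Fin m → ℕ
  mid i = midIdx t (n i)

  mid≢0 : ∀ i → mid i ≢ 0
  mid≢0 i mid≡0 = ≤⇒≯ (proj₁ (interior-at i)) (≤-reflexive (cong suc mid≡0))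

  mid<n : ∀ i → mid i < n i
  mid<n i = proj₂ (interior-at i)

  vertex-≡ : ∀ {u v} → cyc u ≡ cyc v → pos u ≡ pos v → u ≡ v
  vertex-≡ {i , _} cu≡cv pu≡pv with toℕ-injective cu≡cv
  ... | refl = cong (i ,_) (toℕ-injective pu≡pv)

  -- The identification is an equivalence; transitivity needs mid ≢ 0, since
  -- otherwise a vertex could be identified both forwards and backwards.
  ≈-refl : ∀ {u} → u ≈ u
  ≈-refl = inj₁ refl

  ≈-sym : ∀ {u v} → u ≈ v → v ≈ u
  ≈-sym (inj₁ refl)     = inj₁ refl
  ≈-sym (inj₂ (inj₁ p)) = inj₂ (inj₂ p)
  ≈-sym (inj₂ (inj₂ p)) = inj₂ (inj₁ p)

  ≈-trans : ∀ {a b c} → a ≈ b → b ≈ c → a ≈ c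
  ≈-trans (inj₁ refl) b≈c = b≈c
  ≈-trans a≈b (inj₁ refl) = a≈b
  ≈-trans {b = b} (inj₂ (inj₁ (_ , _ , b₀))) (inj₂ (inj₁ (_ , b-mid , _))) =
    ⊥-elim (mid≢0 (proj₁ b) (trans (sym b-mid) b₀))
  ≈-trans (inj₂ (inj₁ (a→b , a-mid , _))) (inj₂ (inj₂ (c→b , c-mid , _))) =
    inj₁ (vertex-≡ same-cyc (trans a-mid (trans (cong mid (toℕ-injective same-cyc)) (sym c-mid))))
    where same-cyc = suc-injective (trans a→b (sym c→b))
  ≈-trans (inj₂ (inj₂ (b→a , _ , a₀))) (inj₂ (inj₁ (b→c , _ , c₀))) =
    inj₁ (vertex-≡ (trans (sym b→a) b→c) (trans a₀ (sym c₀)))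
  ≈-trans {b = b} (inj₂ (inj₂ (_ , b-mid , _))) (inj₂ (inj₂ (_ , _ , b₀))) =
    ⊥-elim (mid≢0 (proj₁ b) (trans (sym b-mid) b₀))

  Adj-sym : ∀ {u w} → Adj u w → Adj w u
  Adj-sym (u' , w' , u≈u' , w≈w' , same , e) =
    w' , u' , w≈w' , u≈u' , sym same , subst (λ i → CAdj (n i) _ _) same (CAdj-sym e)

  Adj-respˡ : ∀ {u u'' w} → u ≈ u'' → Adj u w → Adj u'' w
  Adj-respˡ u≈u'' (u' , w' , u≈u' , w≈w' , e) = u' , w' , ≈-trans (≈-sym u≈u'') u≈u' , w≈w' , e

  Walk-respˡ : ∀ {a b c k} → a ≈ c → Walk a b k → Walk c b k
  Walk-respˡ a≈c (here a≈b)  = here (≈-trans (≈-sym a≈c) a≈b)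
  Walk-respˡ a≈c (step e ws) = step (Adj-respˡ a≈c e) ws

  snoc : ∀ {a b c k} → Walk a b k → Adj b c → Walk a c (suc k)
  snoc (here a≈b)  e' = step (Adj-respˡ (≈-sym a≈b) e') (here ≈-refl)
  snoc (step e ws) e' = step e (snoc ws e')

  reverse : ∀ {a b k} → Walk a b k → Walk b a k
  reverse (here a≈b)  = here (≈-sym a≈b)
  reverse (step e ws) = snoc (reverse ws) (Adj-sym e)

  _++_ : ∀ {a b c k j} → Walk a b k → Walk b c j → Walk a c (k + j)
  here a≈b  ++ ws' = Walk-respˡ (≈-sym a≈b) ws'
  step e ws ++ ws' = step e (ws ++ ws')

  Connected : V → V → Set
  Connected u v = ∃ (Walk u v)

  Connected-trans : ∀ {a b c} → Connected a b → Connected b c → Connected a c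
  Connected-trans (k , ab) (j , bc) = k + j , ab ++ bc

  Connected-sym : ∀ {a b} → Connected a b → Connected b a
  Connected-sym (k , ab) = k , reverse ab

  0<n : ∀ i → 0 < n i
  0<n i = ≤-<-trans z≤n (mid<n i)

  start : Fin m → V
  start i = i , fromℕ< (0<n i)

  descend : ∀ i k (k<n : k < n i) → Walk (i , fromℕ< k<n) (start i) k
  descend i zero    k<n = here ≈-refl
  descend i (suc k) k+1<n = step backwards (descend i k k<n)
    where
    k<n : k < n i
    k<n = <-trans (n<1+n k) k+1<n
    backwards : Adj (i , fromℕ< k+1<n) (i , fromℕ< k<n)
    backwards = _ , _ , ≈-refl , ≈-refl , refl ,
                inj₂ (inj₁ (trans (cong suc (toℕ-fromℕ< k<n)) (sym (toℕ-fromℕ< k+1<n))))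

  to-start : ∀ u → Connected u (start (proj₁ u))
  to-start (i , p) = toℕ p , Walk-respˡ (inj₁ (vertex-≡ refl (toℕ-fromℕ< (toℕ<n p)))) (descend i (toℕ p) (toℕ<n p))

  -- The first vertex of cycle i is the attachment vertex of cycle i - 1.
  start-to-previous : ∀ {i j} → suc (toℕ j) ≡ toℕ i → Connected (start i) (start j)
  start-to-previous {i} {j} j→i = mid j , Walk-respˡ (inj₂ (inj₁ attached)) (descend j (mid j) (mid<n j))
    where
    attached : Ident (j , fromℕ< (mid<n j)) (start i)
    attached = j→i , toℕ-fromℕ< (mid<n j) , toℕ-fromℕ< (0<n i)

  start-to-first : ∀ k i → toℕ i ≡ k → ∀ i₀ → toℕ i₀ ≡ 0 → Connected (start i) (start i₀)
  start-to-first zero i i≡0 i₀ i₀≡0 with toℕ-injective (trans i≡0 (sym i₀≡0))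
  ... | refl = 0 , here ≈-refl
  start-to-first (suc k) i i≡k+1 i₀ i₀≡0 =
    let (j , j→i) = predecessor i (subst (1 ≤_) (sym i≡k+1) (s≤s z≤n)) in
    Connected-trans (start-to-previous j→i)
                    (start-to-first k j (suc-injective (trans j→i i≡k+1)) i₀ i₀≡0)

  -- The chain cycle is connected: everything is connected to the first vertex of the first cycle.
  connected : ∀ u v → Connected u v
  connected u v =
    let (i₀ , i₀≡0) = first-index (proj₁ u)
        to-base : ∀ w → Connected w (start i₀)
        to-base w = Connected-trans (to-start w) (start-to-first _ (proj₁ w) refl i₀ i₀≡0)
    in Connected-trans (to-base u) (Connected-sym (to-base v))

  record Separates (x : V) (P Q : V → Set) : Set where
    field
      classify : ∀ u → P u ⊎ u ≈ x ⊎ Q u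
      P-avoids-x : ∀ {u} → P u → ¬ u ≈ x
      Q-avoids-x : ∀ {u} → Q u → ¬ u ≈ x
      P≉Q : ∀ {u w} → P u → Q w → ¬ u ≈ w
      P≁Q : ∀ {u w} → P u → Q w → ¬ Adj u w

  swap : ∀ {x P Q} → Separates x P Q → Separates x Q P
  swap sep = record
    { classify   = λ u → swap-sides (classify u)
    ; P-avoids-x = Q-avoids-x
    ; Q-avoids-x = P-avoids-x
    ; P≉Q        = λ qu pw u≈w → P≉Q pw qu (≈-sym u≈w)
    ; P≁Q        = λ qu pw u~w → P≁Q pw qu (Adj-sym u~w)
    }
    where
    open Separates sep
    swap-sides : ∀ {A B C : Set} → A ⊎ B ⊎ C → C ⊎ B ⊎ A
    swap-sides (inj₁ a)        = inj₂ (inj₂ a)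
    swap-sides (inj₂ (inj₁ b)) = inj₂ (inj₁ b)
    swap-sides (inj₂ (inj₂ c)) = inj₁ c

  module _ {x P Q} (sep : Separates x P Q) where
    open Separates sep

    closed-or-Q : ∀ u → (P u ⊎ u ≈ x) ⊎ Q u
    closed-or-Q u with classify u
    ... | inj₁ pu          = inj₁ (inj₁ pu)
    ... | inj₂ (inj₁ u≈x)  = inj₁ (inj₂ u≈x)
    ... | inj₂ (inj₂ qu)   = inj₂ qu

    passes-through : ∀ {u v k} → P u ⊎ u ≈ x → Q v → Walk u v k → ∃ λ k' → k' < k × Walk u x k'
    passes-through (inj₁ pu)  qv (here u≈v) = ⊥-elim (P≉Q pu qv u≈v)
    passes-through (inj₂ u≈x) qv (here u≈v) = ⊥-elim (Q-avoids-x qv (≈-trans (≈-sym u≈v) u≈x))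
    passes-through (inj₂ u≈x) qv (step _ _) = 0 , s≤s z≤n , here u≈x
    passes-through (inj₁ pu)  qv (step {w = u₁} u~u₁ rest) with closed-or-Q u₁
    ... | inj₂ qu₁ = ⊥-elim (P≁Q pu qu₁ u~u₁)
    ... | inj₁ u₁-closed =
      let (k' , k'<k , u₁⇝x) = passes-through u₁-closed qv rest
      in suc k' , s≤s k'<k , step u~u₁ u₁⇝x

  shortcut⇒¬max-dist : ∀ {x y w} → Adj x w
    → (∀ {a} → Walk y w a → ∃ λ k → k < a × Walk y x k)
    → ¬ MaxDistFrom x y
  shortcut⇒¬max-dist {x} {y} {w} x~w shortcut x-max-dist =
    let (c , x⇝y) = connected x y in
    least-witness c x⇝y λ (b , x⇝y-b , b-least) →
    least-witness (suc b) (snoc (reverse x⇝y-b) x~w) λ (a , y⇝w , a-least) →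
    let (k , k<a , y⇝x) = shortcut y⇝w
        a≤b = x-max-dist w x~w a b (y⇝w , a-least) (x⇝y-b , b-least)
    in ≤⇒≯ (b-least k (reverse y⇝x)) (<-≤-trans k<a a≤b)

  separator-¬max-dist : ∀ {x P Q y w} → Separates x P Q → P y ⊎ y ≈ x → Q w → Adj x w
    → ¬ MaxDistFrom x y
  separator-¬max-dist sep y-closed qw x~w =
    shortcut⇒¬max-dist x~w (passes-through sep y-closed qw)

  module First-vertex (x : V) (x₀ : pos x ≡ 0) where
    I : ℕ
    I = cyc x

    Before After : V → Set
    Before u = cyc u < I × ¬ u ≈ x
    After  u = I ≤ cyc u × ¬ u ≈ x

    is-x : ∀ {u} → cyc u ≡ I → pos u ≡ 0 → u ≡ x
    is-x same u₀ = vertex-≡ same (trans u₀ (sym x₀))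

    -- Besides x itself, only the attachment vertex of cycle I - 1 is identified with x.
    not-x : ∀ {u} → ¬ (suc (cyc u) ≡ I × pos u ≡ mid (proj₁ u)) → ¬ (cyc u ≡ I × pos u ≡ 0) → ¬ u ≈ x
    not-x _ not-first (inj₁ refl) = not-first (refl , x₀)
    not-x not-attached _ (inj₂ (inj₁ (u→x , u-mid , _))) = not-attached (u→x , u-mid)
    not-x _ _ (inj₂ (inj₂ (_ , x-mid , _))) = mid≢0 (proj₁ x) (trans (sym x-mid) x₀)

    ≈x? : ∀ u → Dec (u ≈ x)
    ≈x? u with suc (cyc u) ≟ I ×-dec pos u ≟ mid (proj₁ u) | cyc u ≟ I ×-dec pos u ≟ 0
    ... | yes (u→x , u-mid) | _                = yes (inj₂ (inj₁ (u→x , u-mid , x₀)))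
    ... | no _              | yes (same , u₀)  = yes (inj₁ (is-x same u₀))
    ... | no not-attached   | no not-first     = no (not-x not-attached not-first)

    -- Both sides are closed under identification: crossing from cycle I - 1 to
    -- cycle I through an identification means passing through x.
    Before-closed : ∀ {u w} → Before u → u ≈ w → Before w
    Before-closed {u} {w} (u<I , u≉x) u≈w = cyc-w<I u≈w , λ w≈x → u≉x (≈-trans u≈w w≈x)
      where
      cyc-w<I : u ≈ w → cyc w < I
      cyc-w<I (inj₁ refl) = u<I
      cyc-w<I (inj₂ (inj₁ (u→w , _ , w₀))) =
        ≤∧≢⇒< (subst (_≤ I) u→w u<I) (λ w≡I → u≉x (≈-trans u≈w (inj₁ (is-x w≡I w₀))))
      cyc-w<I (inj₂ (inj₂ (w→u , _ , _))) = <-trans (≤-reflexive w→u) u<I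

    After-closed : ∀ {u w} → After u → u ≈ w → After w
    After-closed {u} {w} (I≤u , u≉x) u≈w = I≤cyc-w u≈w , λ w≈x → u≉x (≈-trans u≈w w≈x)
      where
      I≤cyc-w : u ≈ w → I ≤ cyc w
      I≤cyc-w (inj₁ refl) = I≤u
      I≤cyc-w (inj₂ (inj₁ (u→w , _ , _))) = ≤-trans I≤u (≤-trans (n≤1+n (cyc u)) (≤-reflexive u→w))
      I≤cyc-w (inj₂ (inj₂ (w→u , _ , u₀))) =
        s≤s⁻¹ (subst (I <_) (sym w→u) (≤∧≢⇒< I≤u (λ I≡u → u≉x (inj₁ (is-x (sym I≡u) u₀)))))

    separates : Separates x Before After
    separates = record
      { classify   = classify
      ; P-avoids-x = proj₂
      ; Q-avoids-x = proj₂
      ; P≉Q        = λ bu aw u≈w → <⇒≱ (proj₁ (Before-closed bu u≈w)) (proj₁ aw)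
      ; P≁Q        = λ { bu aw (_ , _ , u≈u' , w≈w' , same-cycle , _) →
                           <⇒≱ (subst (λ i → toℕ i < I) same-cycle (proj₁ (Before-closed bu u≈u')))
                               (proj₁ (After-closed aw w≈w')) }
      }
      where
      classify : ∀ u → Before u ⊎ u ≈ x ⊎ After u
      classify u with ≈x? u
      ... | yes u≈x = inj₂ (inj₁ u≈x)
      ... | no u≉x with cyc u <? I
      ...   | yes u<I = inj₁ (u<I , u≉x)
      ...   | no u≮I  = inj₂ (inj₂ (≮⇒≥ u≮I , u≉x))

    1<n : 1 < n (proj₁ x)
    1<n = ≤-<-trans (proj₁ (interior-at (proj₁ x))) (mid<n (proj₁ x))

    next : V
    next = proj₁ x , fromℕ< 1<n

    next-After : After next
    next-After = ≤-refl , not-x (λ (I+1≡I , _) → 1+n≢n I+1≡I)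
                                (λ (_ , one≡0) → 1+n≢0 (trans (sym (toℕ-fromℕ< 1<n)) one≡0))

    x~next : Adj x next
    x~next = x , next , ≈-refl , ≈-refl , refl , inj₁ (trans (cong suc x₀) (sym (toℕ-fromℕ< 1<n)))

    module _ (1≤I : 1 ≤ I) where
      j : Fin m
      j = proj₁ (predecessor (proj₁ x) 1≤I)

      j→x : suc (toℕ j) ≡ I
      j→x = proj₂ (predecessor (proj₁ x) 1≤I)

      c : ℕ
      c = pred (mid j)

      c+1≡mid : suc c ≡ mid j
      c+1≡mid = suc-pred (mid j) {{>-nonZero (proj₁ (interior-at j))}}

      c<n : c < n j
      c<n = ≤-trans (≤-reflexive c+1≡mid) (<⇒≤ (mid<n j))

      attachment previous : V
      attachment = j , fromℕ< (mid<n j)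
      previous   = j , fromℕ< c<n

      previous-Before : Before previous
      previous-Before =
        ≤-reflexive j→x ,
        not-x (λ (_ , c≡mid) → 1+n≢n (sym (trans (trans (sym (toℕ-fromℕ< c<n)) c≡mid) (sym c+1≡mid))))
              (λ (j≡I , _) → 1+n≢n (trans j→x (sym j≡I)))

      x~previous : Adj x previous
      x~previous =
        attachment , previous , inj₂ (inj₂ (j→x , toℕ-fromℕ< (mid<n j) , x₀)) , ≈-refl , refl ,
        inj₂ (inj₁ (trans (cong suc (toℕ-fromℕ< c<n)) (trans c+1≡mid (sym (toℕ-fromℕ< (mid<n j))))))

    -- v^I_1 with I ≥ 1 is maximally distant from no vertex: whatever side y is on,
    -- x has a neighbour on the other side.
    x-¬max-dist : 1 ≤ I → ∀ y → ¬ MaxDistFrom x y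
    x-¬max-dist 1≤I y with Separates.classify separates y
    ... | inj₁ before     = separator-¬max-dist separates (inj₁ before) next-After x~next
    ... | inj₂ (inj₁ y≈x) = separator-¬max-dist separates (inj₂ y≈x) next-After x~next
    ... | inj₂ (inj₂ after) =
      separator-¬max-dist (swap separates) (inj₁ after) (previous-Before 1≤I) (x~previous 1≤I)

lemma3p2 : (t : ChainType) (m : ℕ) (n : Fin m → ℕ)
    → (∀ i → 3 ≤ n i) → (∀ i → TypeOK t (n i))
    → (x y : ChainCycle.V n t) → ChainCycle.InV₁ n t x
    → ¬ ChainCycle.MutuallyMaxDist n t x y
lemma3p2 t m n 3≤n parity x y (1≤I , x₀) (x-max-dist , _) =
  First-vertex.x-¬max-dist x x₀ 1≤I y x-max-dist
  where open Interior-chain n t (λ i → interior t (3≤n i) (parity i))
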